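{- Let $n>3$ and let $0<a_1<a_2<\dots<a_n$ be real numbers. Let $\vec{C}=(c_1,\dots,c_n)$ be an ordering of $a_1,\dots,a_n$. If $c_n=a_n$, then $\vec{C}$ is not an optimal sequence, i.e. there is another ordering $\vec{C}'$ with $f(\vec{C}')>f(\vec{C})$.
   Context: For an ordering $\vec{C}=(c_1,\dots,c_n)$ of $a_1,\dots,a_n$, its partial sums are $s_k=\sum_{i=1}^k c_i$ ($1\le k\le n$), with mean $\overline{S}=\frac1n\sum_{k=1}^n s_k$, and $f(\vec{C})=\frac1n\sum_{k=1}^n (s_k-\overline{S})^2$. An ordering is called optimal if it maximizes $f$ over all orderings of $a_1,\dots,a_n$. -}

module Defs where

open import Level using (0ℓ)
open import Data.Nat as ℕ using (ℕ; zero; suc)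
open import Data.Fin using (Fin; zero; suc; toℕ; inject≤)
open import Data.Fin.Properties using (toℕ<n)
open import Data.Fin.Permutation using (Permutation′; _⟨$⟩ʳ_)
open import Data.Product using (Σ; ∃)
open import Relation.Binary.PropositionalEquality using (_≡_)
open import Relation.Binary.Structures using (IsStrictTotalOrder)
open import Relation.Nullary using (¬_)
open import Algebra.Structures using (IsCommutativeRing)

record OrderedField : Set₁ where
  infixl 6 _+_ _-_
  infixl 7 _*_
  infix 4 _<_
  field
    Carrier : Set
    _+_ _*_ : Carrier → Carrier → Carrier
    -_      : Carrier → Carrier
    0# 1#   : Carrier
    _⁻¹     : Carrier → Carrier
    _<_     : Carrier → Carrier → Set
    isCommutativeRing : IsCommutativeRing _≡_ _+_ _*_ -_ 0# 1#
    0≢1     : ¬ (0# ≡ 1#)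
    ⁻¹-inverse : ∀ x → ¬ (x ≡ 0#) → x * (x ⁻¹) ≡ 1#
    isStrictTotalOrder : IsStrictTotalOrder _≡_ _<_
    +-mono-< : ∀ {x y} z → x < y → x + z < y + z
    *-pos    : ∀ {x y} → 0# < x → 0# < y → 0# < x * y

  _-_ : Carrier → Carrier → Carrier
  x - y = x + (- y)

  ι : ℕ → Carrier
  ι zero    = 0#
  ι (suc k) = 1# + ι k

  sumF : ∀ {n} → (Fin n → Carrier) → Carrier
  sumF {zero}  g = 0#
  sumF {suc n} g = g zero + sumF (λ i → g (suc i))

  -- partial sums s_k = c_1 + ... + c_k  (index k : Fin n stands for k+1)
  partialSum : ∀ {n} → (Fin n → Carrier) → Fin n → Carrier
  partialSum {n} c k = sumF (λ (i : Fin (suc (toℕ k))) → c (inject≤ i (toℕ<n k)))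

  meanS : ∀ {n} → (Fin n → Carrier) → Carrier
  meanS {n} c = (ι n ⁻¹) * sumF (partialSum c)

  f : ∀ {n} → (Fin n → Carrier) → Carrier
  f {n} c = (ι n ⁻¹) * sumF (λ k → (partialSum c k - meanS c) * (partialSum c k - meanS c))

  ordering : ∀ {n} → (Fin n → Carrier) → Permutation′ n → (Fin n → Carrier)
  ordering a σ i = a (σ ⟨$⟩ʳ i)

-- Since c_n = a_n is the largest term, b = c_{n-1} < a = c_n. Swapping these two
-- changes only the partial sum s_{n-1}, raising it by a - b, and raising a single
-- entry v_j of a vector to w_j changes its variance by (w_j - v_j)/n times the sum of
-- the deviations v_j - mean v and w_j - mean w. Now n (s_{n-1} - mean s) =
-- Σ_k (s_{n-1} - s_k) ≥ (n - 2) b - a, because s_{n-1} exceeds each of s_1, …, s_{n-2}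
-- by at least b and falls short of s_n by a; the same bound for the swapped order
-- reads (n - 2) a - b, so the two deviations add up to at least (n - 3)(a + b)/n > 0.

module Submission where

open import Level using (0ℓ)
open import Data.Nat as ℕ using (ℕ; zero; suc; s≤s; z≤n)
open import Data.Fin as Fin using (Fin; zero; suc; fromℕ; inject₁; inject≤)
open import Data.Fin.Properties using (_≟_; toℕ<n; suc-injective; <-cmp; ≤fromℕ; ≤∧≢⇒<; fromℕ≢inject₁)
open import Data.Fin.Permutation using (Permutation′; transpose; lift₀; lift₀-transpose; _⟨$⟩ʳ_; _⟨$⟩ˡ_; inverseˡ; _∘ₚ_)
open import Data.Product using (Σ; _×_; _,_)
open import Data.Sum using (inj₁; inj₂)
open import Data.Maybe using (just; nothing)
open import Function using (_∘_)
open import Relation.Nullary using (yes; no; contradiction)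
open import Relation.Nullary.Decidable using (dec-true)
import Relation.Binary.PropositionalEquality as ≡
open ≡ using (_≡_; _≢_)
open import Relation.Binary.Definitions using (WeaklyDecidable; tri<; tri≈; tri>)
open import Relation.Binary.Structures using (IsStrictTotalOrder)
open import Algebra.Bundles using (CommutativeRing; RawRing)
open import Algebra.Solver.Ring.AlmostCommutativeRing
  using (fromCommutativeRing; _-Raw-AlmostCommutative⟶_)
open import Defs

-- A ring solver for arbitrary commutative rings: the coefficients are integers,
-- encoded as pairs (m , n) of naturals standing for m - n.
module RingSolver {c ℓ} (R : CommutativeRing c ℓ) where
  open CommutativeRing R
  open import Algebra.Properties.Ring ring
  open import Algebra.Properties.CommutativeSemigroup +-commutativeSemigroup using (interchange)
  open import Algebra.Properties.Semiring.Mult.TCOptimised semiring using (1+×; ×-homo-+; ×1-homo-*)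
    renaming (_×_ to _×′_)
  open import Relation.Binary.Reasoning.Setoid setoid

  ℕ-differences : RawRing 0ℓ 0ℓ
  ℕ-differences = record
    { Carrier = ℕ × ℕ
    ; _≈_ = _≡_
    ; _+_ = λ { (a , b) (c , d) → (a ℕ.+ c , b ℕ.+ d) }
    ; _*_ = λ { (a , b) (c , d) → (a ℕ.* c ℕ.+ b ℕ.* d , a ℕ.* d ℕ.+ b ℕ.* c) }
    ; -_ = λ { (a , b) → (b , a) }
    ; 0# = (0 , 0)
    ; 1# = (1 , 0)
    }

  -- Defined by cases rather than as m ×′ 1# - n ×′ 1#, so that closed
  -- coefficients such as (1 , 0) evaluate to 1# itself.
  ⟦_⟧ : ℕ × ℕ → Carrier
  ⟦ m , zero ⟧ = m ×′ 1#
  ⟦ zero , suc n ⟧ = - (suc n ×′ 1#)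
  ⟦ suc m , suc n ⟧ = ⟦ m , n ⟧

  [x+y]-[z+y]≈x-z : ∀ x y z → (x + y) - (z + y) ≈ x - z
  [x+y]-[z+y]≈x-z x y z = begin
    (x + y) + - (z + y)    ≈⟨ +-congˡ (-‿+-comm z y) ⟨
    (x + y) + (- z + - y)  ≈⟨ interchange x y (- z) (- y) ⟩
    (x - z) + (y - y)      ≈⟨ +-congˡ (-‿inverseʳ y) ⟩
    (x - z) + 0#           ≈⟨ +-identityʳ _ ⟩
    x - z                  ∎

  [x+y]-[z+w]≈[x-z]+[y-w] : ∀ x y z w → (x + y) - (z + w) ≈ (x - z) + (y - w)
  [x+y]-[z+w]≈[x-z]+[y-w] x y z w = begin
    (x + y) + - (z + w)    ≈⟨ +-congˡ (-‿+-comm z w) ⟨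
    (x + y) + (- z + - w)  ≈⟨ interchange x y (- z) (- w) ⟩
    (x - z) + (y - w)      ∎

  ⟦⟧-difference : ∀ m n → ⟦ m , n ⟧ ≈ m ×′ 1# - n ×′ 1#
  ⟦⟧-difference m zero = begin
    m ×′ 1#       ≈⟨ +-identityʳ _ ⟨
    m ×′ 1# + 0#  ≈⟨ +-congˡ -0#≈0# ⟨
    m ×′ 1# - 0#  ∎
  ⟦⟧-difference zero (suc n) = sym (+-identityˡ _)
  ⟦⟧-difference (suc m) (suc n) = begin
    ⟦ m , n ⟧                        ≈⟨ ⟦⟧-difference m n ⟩
    m ×′ 1# - n ×′ 1#                ≈⟨ [x+y]-[z+y]≈x-z _ 1# _ ⟨
    (m ×′ 1# + 1#) - (n ×′ 1# + 1#)  ≈⟨ +-cong (1+×′ m) (-‿cong (1+×′ n)) ⟩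
    suc m ×′ 1# - suc n ×′ 1#        ∎
    where
    1+×′ : ∀ k → k ×′ 1# + 1# ≈ suc k ×′ 1#
    1+×′ k = trans (+-comm _ _) (sym (1+× k 1#))

  +-homo : ∀ x y → ⟦ RawRing._+_ ℕ-differences x y ⟧ ≈ ⟦ x ⟧ + ⟦ y ⟧
  +-homo (a , b) (c , d) = begin
    ⟦ a ℕ.+ c , b ℕ.+ d ⟧                      ≈⟨ ⟦⟧-difference (a ℕ.+ c) (b ℕ.+ d) ⟩
    (a ℕ.+ c) ×′ 1# - (b ℕ.+ d) ×′ 1#          ≈⟨ +-cong (×-homo-+ 1# a c) (-‿cong (×-homo-+ 1# b d)) ⟩
    (a ×′ 1# + c ×′ 1#) - (b ×′ 1# + d ×′ 1#)  ≈⟨ [x+y]-[z+w]≈[x-z]+[y-w] _ _ _ _ ⟩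
    (a ×′ 1# - b ×′ 1#) + (c ×′ 1# - d ×′ 1#)  ≈⟨ +-cong (⟦⟧-difference a b) (⟦⟧-difference c d) ⟨
    ⟦ a , b ⟧ + ⟦ c , d ⟧                      ∎

  *-homo : ∀ x y → ⟦ RawRing._*_ ℕ-differences x y ⟧ ≈ ⟦ x ⟧ * ⟦ y ⟧
  *-homo (a , b) (c , d) = begin
    ⟦ a ℕ.* c ℕ.+ b ℕ.* d , a ℕ.* d ℕ.+ b ℕ.* c ⟧
      ≈⟨ ⟦⟧-difference (a ℕ.* c ℕ.+ b ℕ.* d) (a ℕ.* d ℕ.+ b ℕ.* c) ⟩
    (a ℕ.* c ℕ.+ b ℕ.* d) ×′ 1# - (a ℕ.* d ℕ.+ b ℕ.* c) ×′ 1#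
      ≈⟨ +-cong (×-homo-+ 1# (a ℕ.* c) (b ℕ.* d)) (-‿cong (×-homo-+ 1# (a ℕ.* d) (b ℕ.* c))) ⟩
    ((a ℕ.* c) ×′ 1# + (b ℕ.* d) ×′ 1#) - ((a ℕ.* d) ×′ 1# + (b ℕ.* c) ×′ 1#)
      ≈⟨ +-cong (+-cong (×1-homo-* a c) (×1-homo-* b d)) (-‿cong (+-cong (×1-homo-* a d) (×1-homo-* b c))) ⟩
    (A * C + B * D) - (A * D + B * C)  ≈⟨ [x+y]-[z+w]≈[x-z]+[y-w] _ _ _ _ ⟩
    (A * C - A * D) + (B * D - B * C)  ≈⟨ +-cong (x[y-z]≈xy-xz A C D) (x[y-z]≈xy-xz B D C) ⟨
    A * (C - D) + B * (D - C)          ≈⟨ +-congˡ (*-congˡ (⁻¹-anti-homo‿- C D)) ⟨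
    A * (C - D) + B * - (C - D)        ≈⟨ +-congˡ (-‿distribʳ-* B (C - D)) ⟨
    A * (C - D) - B * (C - D)          ≈⟨ [y-z]x≈yx-zx (C - D) A B ⟨
    (A - B) * (C - D)                  ≈⟨ *-cong (⟦⟧-difference a b) (⟦⟧-difference c d) ⟨
    ⟦ a , b ⟧ * ⟦ c , d ⟧              ∎
    where
    A = a ×′ 1#
    B = b ×′ 1#
    C = c ×′ 1#
    D = d ×′ 1#

  -‿homo : ∀ x → ⟦ RawRing.-_ ℕ-differences x ⟧ ≈ - ⟦ x ⟧
  -‿homo (a , b) = begin
    ⟦ b , a ⟧              ≈⟨ ⟦⟧-difference b a ⟩
    b ×′ 1# - a ×′ 1#      ≈⟨ ⁻¹-anti-homo‿- _ _ ⟨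
    - (a ×′ 1# - b ×′ 1#)  ≈⟨ -‿cong (⟦⟧-difference a b) ⟨
    - ⟦ a , b ⟧            ∎

  morphism : ℕ-differences -Raw-AlmostCommutative⟶ fromCommutativeRing R
  morphism = record
    { ⟦_⟧ = ⟦_⟧
    ; +-homo = +-homo
    ; *-homo = *-homo
    ; -‿homo = -‿homo
    ; 0-homo = refl
    ; 1-homo = refl
    }

  ⟦⟧-≟ : WeaklyDecidable (λ x y → ⟦ x ⟧ ≈ ⟦ y ⟧)
  ⟦⟧-≟ (a , b) (c , d) with a ℕ.+ d ℕ.≟ c ℕ.+ b
  ... | no _  = nothing
  ... | yes a+d≡c+b = just (begin
    ⟦ a , b ⟧                                  ≈⟨ ⟦⟧-difference a b ⟩
    a ×′ 1# - b ×′ 1#                          ≈⟨ [x+y]-[z+y]≈x-z _ (d ×′ 1#) _ ⟨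
    (a ×′ 1# + d ×′ 1#) - (b ×′ 1# + d ×′ 1#)  ≈⟨ +-cong A+D≈C+B (-‿cong (+-comm _ _)) ⟩
    (c ×′ 1# + b ×′ 1#) - (d ×′ 1# + b ×′ 1#)  ≈⟨ [x+y]-[z+y]≈x-z _ (b ×′ 1#) _ ⟩
    c ×′ 1# - d ×′ 1#                          ≈⟨ ⟦⟧-difference c d ⟨
    ⟦ c , d ⟧                                  ∎)
    where
    A+D≈C+B : a ×′ 1# + d ×′ 1# ≈ c ×′ 1# + b ×′ 1#
    A+D≈C+B = begin
      a ×′ 1# + d ×′ 1#  ≈⟨ ×-homo-+ 1# a d ⟨
      (a ℕ.+ d) ×′ 1#    ≡⟨ ≡.cong (_×′ 1#) a+d≡c+b ⟩
      (c ℕ.+ b) ×′ 1#    ≈⟨ ×-homo-+ 1# c b ⟩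
      c ×′ 1# + b ×′ 1#  ∎

  open import Algebra.Solver.Ring ℕ-differences (fromCommutativeRing R) morphism ⟦⟧-≟ public
    using (solve; _:=_; _:+_; _:*_; _:-_; :-_; con)

module OrderedFieldProperties (F : OrderedField) where
  open OrderedField F
  open ≡ using (refl; sym; trans; cong; cong₂; subst; subst₂; module ≡-Reasoning)

  commutativeRing : CommutativeRing 0ℓ 0ℓ
  commutativeRing = record { isCommutativeRing = isCommutativeRing }

  open CommutativeRing commutativeRing
    using (+-assoc; +-comm; +-identityˡ; +-identityʳ; *-assoc; *-identityˡ; -‿inverseʳ; zeroʳ)
  open RingSolver commutativeRing
  open IsStrictTotalOrder isStrictTotalOrder using (compare)
    renaming (trans to <-trans; irrefl to <-irrefl)
  open import Relation.Binary.Construct.StrictToNonStrict _≡_ _<_ using (_≤_; isTotalOrder)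
  open import Relation.Binary.Structures using (IsTotalOrder)
  open IsTotalOrder (isTotalOrder isStrictTotalOrder) using () renaming (trans to ≤-trans)

  0<-x : ∀ {x} → x < 0# → 0# < - x
  0<-x {x} x<0 = subst₂ _<_ (-‿inverseʳ x) (+-identityˡ (- x)) (+-mono-< (- x) x<0)

  x<y⇒0<y-x : ∀ {x y} → x < y → 0# < y - x
  x<y⇒0<y-x {x} {y} x<y = subst (_< y - x) (-‿inverseʳ x) (+-mono-< (- x) x<y)

  0<y-x⇒x<y : ∀ {x y} → 0# < y - x → x < y
  0<y-x⇒x<y {x} {y} 0<y-x =
    subst₂ _<_ (+-identityˡ x) (solve 2 (λ x y → (y :- x) :+ x := y) refl x y) (+-mono-< x 0<y-x)

  x≤y⇒0≤y-x : ∀ {x y} → x ≤ y → 0# ≤ y - x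
  x≤y⇒0≤y-x (inj₁ x<y)  = inj₁ (x<y⇒0<y-x x<y)
  x≤y⇒0≤y-x (inj₂ refl) = inj₂ (sym (-‿inverseʳ _))

  0≤x∧0<y⇒0<x+y : ∀ {x y} → 0# ≤ x → 0# < y → 0# < x + y
  0≤x∧0<y⇒0<x+y {x} {y} (inj₁ 0<x) 0<y = <-trans 0<y (subst (_< x + y) (+-identityˡ y) (+-mono-< y 0<x))
  0≤x∧0<y⇒0<x+y (inj₂ refl) 0<y = subst (0# <_) (sym (+-identityˡ _)) 0<y

  +-monoˡ-≤ : ∀ z {x y} → x ≤ y → x + z ≤ y + z
  +-monoˡ-≤ z (inj₁ x<y)  = inj₁ (+-mono-< z x<y)
  +-monoˡ-≤ z (inj₂ refl) = inj₂ refl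

  +-mono-≤ : ∀ {x y u v} → x ≤ y → u ≤ v → x + u ≤ y + v
  +-mono-≤ {x} {y} {u} {v} x≤y u≤v = ≤-trans (+-monoˡ-≤ u x≤y)
    (subst₂ _≤_ (+-comm u y) (+-comm v y) (+-monoˡ-≤ y u≤v))

  0<1 : 0# < 1#
  0<1 with compare 0# 1#
  ... | tri< 0<1 _ _ = 0<1
  ... | tri≈ _ 0≡1 _ = contradiction 0≡1 0≢1
  ... | tri> _ _ 1<0 = contradiction (<-trans 1<0 0<[-1]*[-1]) (<-irrefl refl)
    where
    0<[-1]*[-1] : 0# < 1#
    0<[-1]*[-1] = subst (0# <_) (solve 0 (:- con (1 , 0) :* :- con (1 , 0) := con (1 , 0)) refl)
      (*-pos (0<-x 1<0) (0<-x 1<0))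

  0<ι[1+n] : ∀ n → 0# < ι (suc n)
  0<ι[1+n] zero    = subst (0# <_) (sym (+-identityʳ 1#)) 0<1
  0<ι[1+n] (suc n) = 0≤x∧0<y⇒0<x+y (inj₁ 0<1) (0<ι[1+n] n)

  0<x⇒x≢0 : ∀ {x} → 0# < x → x ≢ 0#
  0<x⇒x≢0 0<x refl = <-irrefl refl 0<x

  0<x⇒0<x⁻¹ : ∀ {x} → 0# < x → 0# < x ⁻¹
  0<x⇒0<x⁻¹ {x} 0<x with compare 0# (x ⁻¹)
  ... | tri< 0<x⁻¹ _ _ = 0<x⁻¹
  ... | tri≈ _ 0≡x⁻¹ _ =
    contradiction (trans (sym (zeroʳ x)) (trans (cong (x *_) 0≡x⁻¹) (⁻¹-inverse x (0<x⇒x≢0 0<x)))) 0≢1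
  ... | tri> _ _ x⁻¹<0 = contradiction (0≤x∧0<y⇒0<x+y (inj₁ 0<1) 0<-1) (<-irrefl (sym (-‿inverseʳ 1#)))
    where
    0<-1 : 0# < - 1#
    0<-1 = subst (0# <_)
      (trans (solve 2 (λ x y → x :* :- y := :- (x :* y)) refl x (x ⁻¹)) (cong -_ (⁻¹-inverse x (0<x⇒x≢0 0<x))))
      (*-pos 0<x (0<-x x⁻¹<0))

  ι[1+n]*ι[1+n]⁻¹≡1 : ∀ n → ι (suc n) * ι (suc n) ⁻¹ ≡ 1#
  ι[1+n]*ι[1+n]⁻¹≡1 n = ⁻¹-inverse (ι (suc n)) (0<x⇒x≢0 (0<ι[1+n] n))

  ι[1+n]*[ι[1+n]⁻¹*x]≡x : ∀ n x → ι (suc n) * (ι (suc n) ⁻¹ * x) ≡ x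
  ι[1+n]*[ι[1+n]⁻¹*x]≡x n x = begin
    ι (suc n) * (ι (suc n) ⁻¹ * x)  ≡⟨ sym (*-assoc _ _ x) ⟩
    ι (suc n) * ι (suc n) ⁻¹ * x    ≡⟨ cong (_* x) (ι[1+n]*ι[1+n]⁻¹≡1 n) ⟩
    1# * x                          ≡⟨ *-identityˡ x ⟩
    x                               ∎
    where open ≡-Reasoning

  sumF-cong : ∀ {n} {g h : Fin n → Carrier} → (∀ i → g i ≡ h i) → sumF g ≡ sumF h
  sumF-cong {zero}  g≗h = refl
  sumF-cong {suc n} g≗h = cong₂ _+_ (g≗h zero) (sumF-cong (g≗h ∘ suc))

  sumF-perturb : ∀ {n} {g h : Fin n → Carrier} j → (∀ i → i ≢ j → g i ≡ h i) →
    sumF g ≡ sumF h + (g j - h j)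
  sumF-perturb {suc n} {g} {h} zero g≗h = begin
    g zero + sumF (g ∘ suc)                      ≡⟨ cong (g zero +_) (sumF-cong (λ i → g≗h (suc i) λ ())) ⟩
    g zero + sumF (h ∘ suc)                      ≡⟨ solve 3 (λ x y t → x :+ t := (y :+ t) :+ (x :- y)) refl _ _ _ ⟩
    h zero + sumF (h ∘ suc) + (g zero - h zero)  ∎
    where open ≡-Reasoning
  sumF-perturb {suc n} {g} {h} (suc j) g≗h = begin
    g zero + sumF (g ∘ suc)
      ≡⟨ cong₂ _+_ (g≗h zero λ ()) (sumF-perturb j (λ i i≢j → g≗h (suc i) (i≢j ∘ suc-injective))) ⟩
    h zero + (sumF (h ∘ suc) + (g (suc j) - h (suc j)))  ≡⟨ sym (+-assoc _ _ _) ⟩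
    h zero + sumF (h ∘ suc) + (g (suc j) - h (suc j))    ∎
    where open ≡-Reasoning

  sumF-[x-v] : ∀ {n} x (v : Fin n → Carrier) → sumF (λ k → x - v k) ≡ ι n * x - sumF v
  sumF-[x-v] {zero}  x v = solve 1 (λ x → con (0 , 0) := con (0 , 0) :* x :- con (0 , 0)) refl x
  sumF-[x-v] {suc n} x v = trans (cong (x - v zero +_) (sumF-[x-v] x (v ∘ suc)))
    (solve 4 (λ x v₀ N S → (x :- v₀) :+ (N :* x :- S) := (con (1 , 0) :+ N) :* x :- (v₀ :+ S))
      refl x (v zero) (ι n) (sumF (v ∘ suc)))

  sumF-[v-M]² : ∀ {n} (v : Fin n → Carrier) M →
    sumF (λ k → (v k - M) * (v k - M)) ≡ sumF (λ k → v k * v k) - (M + M) * sumF v + ι n * (M * M)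
  sumF-[v-M]² {zero}  v M = solve 1 (λ M → O := O :- (M :+ M) :* O :+ O :* (M :* M)) refl M
    where O = con (0 , 0)
  sumF-[v-M]² {suc n} v M = trans (cong ((v zero - M) * (v zero - M) +_) (sumF-[v-M]² (v ∘ suc) M))
    (solve 5 (λ x M Q S N → (x :- M) :* (x :- M) :+ (Q :- (M :+ M) :* S :+ N :* (M :* M))
                          := (x :* x :+ Q) :- (M :+ M) :* (x :+ S) :+ (con (1 , 0) :+ N) :* (M :* M))
      refl (v zero) M (sumF (λ k → v (suc k) * v (suc k))) (sumF (v ∘ suc)) (ι n))

  mean : ∀ {n} → (Fin n → Carrier) → Carrier
  mean {n} v = ι n ⁻¹ * sumF v

  variance : ∀ {n} → (Fin n → Carrier) → Carrier
  variance {n} v = ι n ⁻¹ * sumF (λ k → (v k - mean v) * (v k - mean v))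

  f≡variance∘partialSum : ∀ {n} (c : Fin n → Carrier) → f c ≡ variance (partialSum c)
  f≡variance∘partialSum c = refl

  variance-moments : ∀ {n} (v : Fin (suc n) → Carrier) →
    variance v ≡ ι (suc n) ⁻¹ * (sumF (λ k → v k * v k) - ι (suc n) ⁻¹ * (sumF v * sumF v))
  variance-moments {n} v = begin
    variance v                                   ≡⟨ cong (u *_) (sumF-[v-M]² v (u * S)) ⟩
    u * (Q - (u * S + u * S) * S + N * ((u * S) * (u * S)))
      ≡⟨ cong (λ t → u * (Q - (u * S + u * S) * S + N * t))
           (solve 2 (λ u S → (u :* S) :* (u :* S) := u :* (S :* (u :* S))) refl u S) ⟩
    u * (Q - (u * S + u * S) * S + N * (u * (S * (u * S))))
      ≡⟨ cong (λ t → u * (Q - (u * S + u * S) * S + t)) (ι[1+n]*[ι[1+n]⁻¹*x]≡x n _) ⟩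
    u * (Q - (u * S + u * S) * S + S * (u * S))
      ≡⟨ cong (u *_)
           (solve 3 (λ Q u S → Q :- (u :* S :+ u :* S) :* S :+ S :* (u :* S) := Q :- u :* (S :* S)) refl Q u S) ⟩
    u * (Q - u * (S * S))                        ∎
    where
    open ≡-Reasoning
    N = ι (suc n)
    u = ι (suc n) ⁻¹
    S = sumF v
    Q = sumF (λ k → v k * v k)

  excess : ∀ {n} → (Fin n → Carrier) → Fin n → Carrier
  excess v j = sumF (λ k → v j - v k)

  deviation≡mean-excess : ∀ {n} (v : Fin (suc n) → Carrier) j →
    v j - mean v ≡ ι (suc n) ⁻¹ * excess v j
  deviation≡mean-excess {n} v j = sym (begin
    u * excess v j              ≡⟨ cong (u *_) (sumF-[x-v] (v j) v) ⟩
    u * (N * v j - sumF v)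
      ≡⟨ solve 4 (λ u N x S → u :* (N :* x :- S) := N :* (u :* x) :- u :* S) refl u N (v j) (sumF v) ⟩
    N * (u * v j) - u * sumF v  ≡⟨ cong (_- u * sumF v) (ι[1+n]*[ι[1+n]⁻¹*x]≡x n (v j)) ⟩
    v j - mean v                ∎)
    where
    open ≡-Reasoning
    N = ι (suc n)
    u = ι (suc n) ⁻¹

  variance-update : ∀ {n} (v w : Fin (suc n) → Carrier) j → (∀ k → k ≢ j → w k ≡ v k) →
    variance w - variance v ≡ ι (suc n) ⁻¹ * ((w j - v j) * ((w j - mean w) + (v j - mean v)))
  variance-update {n} v w j w≗v = begin
    variance w - variance v
      ≡⟨ cong₂ _-_ (variance-moments w) (variance-moments v) ⟩
    u * (sumF w² - u * (sumF w * sumF w)) - u * (sumF v² - u * (sumF v * sumF v))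
      ≡⟨ cong₂ (λ Q S → u * (Q - u * (S * S)) - u * (sumF v² - u * (sumF v * sumF v))) Q-perturb S-perturb ⟩
    u * ((sumF v² + (w j * w j - v j * v j)) - u * ((sumF v + (w j - v j)) * (sumF v + (w j - v j))))
      - u * (sumF v² - u * (sumF v * sumF v))
      ≡⟨ solve 5 (λ u Q S x y →
           u :* ((Q :+ (y :* y :- x :* x)) :- u :* ((S :+ (y :- x)) :* (S :+ (y :- x)))) :- u :* (Q :- u :* (S :* S))
           := u :* ((y :- x) :* ((y :- u :* (S :+ (y :- x))) :+ (x :- u :* S))))
         refl u (sumF v²) (sumF v) (v j) (w j) ⟩
    u * ((w j - v j) * ((w j - u * (sumF v + (w j - v j))) + (v j - mean v)))
      ≡⟨ cong (λ S → u * ((w j - v j) * ((w j - u * S) + (v j - mean v)))) (sym S-perturb) ⟩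
    u * ((w j - v j) * ((w j - mean w) + (v j - mean v)))  ∎
    where
    open ≡-Reasoning
    u = ι (suc n) ⁻¹
    v² w² : Fin (suc n) → Carrier
    v² k = v k * v k
    w² k = w k * w k
    S-perturb : sumF w ≡ sumF v + (w j - v j)
    S-perturb = sumF-perturb j w≗v
    Q-perturb : sumF w² ≡ sumF v² + (w j * w j - v j * v j)
    Q-perturb = sumF-perturb j (λ k k≢j → cong₂ _*_ (w≗v k k≢j) (w≗v k k≢j))

  variance-increase : ∀ {n} (v w : Fin (suc n) → Carrier) j → (∀ k → k ≢ j → w k ≡ v k) →
    0# < w j - v j → 0# < (w j - mean w) + (v j - mean v) → variance v < variance w
  variance-increase {n} v w j w≗v 0<δ 0<deviations = 0<y-x⇒x<y (subst (0# <_)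
    (sym (variance-update v w j w≗v)) (*-pos (0<x⇒0<x⁻¹ (0<ι[1+n] n)) (*-pos 0<δ 0<deviations)))

  partialSum-cong : ∀ {n} {c d : Fin n → Carrier} → (∀ i → c i ≡ d i) →
    ∀ k → partialSum c k ≡ partialSum d k
  partialSum-cong c≗d k = sumF-cong (λ i → c≗d (inject≤ i (toℕ<n k)))

  ≤-partialSum : ∀ {n} {c : Fin n → Carrier} → (∀ i → 0# ≤ c i) → ∀ k → c k ≤ partialSum c k
  ≤-partialSum c≥0 zero    = inj₂ (sym (+-identityʳ _))
  ≤-partialSum c≥0 (suc k) =
    subst₂ _≤_ (+-identityˡ _) refl (+-mono-≤ (c≥0 zero) (≤-partialSum (c≥0 ∘ suc) k))

  partialSum-transpose-≢ : ∀ {n} (c : Fin (suc n) → Carrier) (i : Fin n) k → k ≢ inject₁ i →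
    partialSum (λ l → c (transpose (inject₁ i) (suc i) ⟨$⟩ʳ l)) k ≡ partialSum c k
  partialSum-transpose-≢ c zero zero          k≢0 = contradiction refl k≢0
  partialSum-transpose-≢ c zero (suc zero)    _   = solve 3 (λ x y z → y :+ (x :+ z) := x :+ (y :+ z)) refl _ _ _
  partialSum-transpose-≢ c zero (suc (suc k)) _   = solve 3 (λ x y z → y :+ (x :+ z) := x :+ (y :+ z)) refl _ _ _
  partialSum-transpose-≢ c (suc i) k k≢i =
    trans (partialSum-cong (λ l → cong c (lift₀-transpose (inject₁ i) (suc i) l)) k) (lifted k k≢i)
    where
    lifted : ∀ k → k ≢ suc (inject₁ i) →
      partialSum (λ l → c (lift₀ (transpose (inject₁ i) (suc i)) ⟨$⟩ʳ l)) k ≡ partialSum c k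
    lifted zero    _   = refl
    lifted (suc k) k≢i = cong (c zero +_) (partialSum-transpose-≢ (c ∘ suc) i k (k≢i ∘ cong suc))

  partialSum-transpose-≡ : ∀ {n} (c : Fin (suc n) → Carrier) (i : Fin n) →
    partialSum (λ l → c (transpose (inject₁ i) (suc i) ⟨$⟩ʳ l)) (inject₁ i) - partialSum c (inject₁ i)
      ≡ c (suc i) - c (inject₁ i)
  partialSum-transpose-≡ c zero =
    solve 3 (λ x y z → (y :+ z) :- (x :+ z) := y :- x) refl (c zero) (c (suc zero)) 0#
  partialSum-transpose-≡ c (suc i) = begin
    partialSum c′ (suc (inject₁ i)) - partialSum c (suc (inject₁ i))
      ≡⟨ cong (_- partialSum c (suc (inject₁ i)))
           (partialSum-cong (λ l → cong c (lift₀-transpose (inject₁ i) (suc i) l)) (suc (inject₁ i))) ⟩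
    (c zero + partialSum (c ∘ suc ∘ (τ ⟨$⟩ʳ_)) (inject₁ i)) - (c zero + partialSum (c ∘ suc) (inject₁ i))
      ≡⟨ solve 3 (λ x y z → (x :+ y) :- (x :+ z) := y :- z) refl (c zero) _ _ ⟩
    partialSum (c ∘ suc ∘ (τ ⟨$⟩ʳ_)) (inject₁ i) - partialSum (c ∘ suc) (inject₁ i)
      ≡⟨ partialSum-transpose-≡ (c ∘ suc) i ⟩
    c (suc (suc i)) - c (suc (inject₁ i))  ∎
    where
    open ≡-Reasoning
    τ = transpose (inject₁ i) (suc i)
    c′ : Fin _ → Carrier
    c′ l = c (transpose (suc (inject₁ i)) (suc (suc i)) ⟨$⟩ʳ l)

  transpose-matchˡ : ∀ {n} (i j : Fin n) → transpose i j ⟨$⟩ʳ i ≡ j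
  transpose-matchˡ i j rewrite dec-true (i ≟ i) refl = refl

  transpose-matchʳ : ∀ {n} (i j : Fin n) → transpose i j ⟨$⟩ʳ j ≡ i
  transpose-matchʳ i j with j ≟ i
  ... | yes refl = refl
  ... | no _ rewrite dec-true (j ≟ j) refl = refl

  excess-bound : ∀ p (c : Fin (suc (suc p)) → Carrier) → (∀ i → 0# ≤ c i) →
    ι p * c (inject₁ (fromℕ p)) ≤ excess (partialSum c) (inject₁ (fromℕ p)) + c (fromℕ (suc p))
  excess-bound zero c c≥0 = inj₂ (solve 2 (λ x y →
    O :* x := (((x :+ O) :- (x :+ O)) :+ (((x :+ O) :- (x :+ (y :+ O))) :+ O)) :+ y)
    refl (c zero) (c (suc zero)))
    where O = con (0 , 0)
  excess-bound (suc p) c c≥0 = subst₂ _≤_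
    (solve 2 (λ P b → b :+ P :* b := (con (1 , 0) :+ P) :* b) refl (ι p) b)
    (trans (sym (+-assoc _ _ _)) (cong (_+ c (fromℕ (suc (suc p)))) (sym excess-step)))
    (+-mono-≤ (≤-partialSum (c≥0 ∘ suc) j) (excess-bound p (c ∘ suc) (c≥0 ∘ suc)))
    where
    j = inject₁ (fromℕ p)
    b = c (suc j)
    t = partialSum (c ∘ suc)
    excess-step : excess (partialSum c) (suc j) ≡ t j + excess t j
    excess-step = cong₂ _+_
      (solve 2 (λ x y → (x :+ y) :- (x :+ con (0 , 0)) := y) refl (c zero) (t j))
      (sumF-cong (λ k → solve 3 (λ x y z → (x :+ y) :- (x :+ z) := y :- z) refl (c zero) (t j) (t k)))

  crossed-bounds⇒0<sum : ∀ k {a b E E′} → 0# < a → 0# < b →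
    ι (suc (suc k)) * b ≤ E + a → ι (suc (suc k)) * a ≤ E′ + b → 0# < E + E′
  crossed-bounds⇒0<sum k {a} {b} {E} {E′} 0<a 0<b bound bound′ = subst (0# <_) (sym split)
    (0≤x∧0<y⇒0<x+y (x≤y⇒0≤y-x (+-mono-≤ bound bound′))
      (*-pos (0<ι[1+n] k) (0≤x∧0<y⇒0<x+y (inj₁ 0<a) 0<b)))
    where
    split : E + E′ ≡ ((E + a) + (E′ + b)) - (ι (suc (suc k)) * b + ι (suc (suc k)) * a) + ι (suc k) * (a + b)
    split = solve 5 (λ E E′ a b K → E :+ E′
      := ((E :+ a) :+ (E′ :+ b)) :- ((con (1 , 0) :+ K) :* b :+ (con (1 , 0) :+ K) :* a) :+ K :* (a :+ b))
      refl E E′ a b (ι (suc k))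

  f-<-f∘transpose-last-two : ∀ k (c : Fin (suc (suc (suc (suc k)))) → Carrier) → (∀ i → 0# < c i) →
    c (inject₁ (fromℕ (suc (suc k)))) < c (fromℕ (suc (suc (suc k)))) →
    f c < f (λ i → c (transpose (inject₁ (fromℕ (suc (suc k)))) (fromℕ (suc (suc (suc k)))) ⟨$⟩ʳ i))
  f-<-f∘transpose-last-two k c 0<c cJ<cL =
    subst₂ _<_ (sym (f≡variance∘partialSum c)) (sym (f≡variance∘partialSum c′))
      (variance-increase s s′ J (partialSum-transpose-≢ c (fromℕ p))
        (subst (0# <_) (sym (partialSum-transpose-≡ c (fromℕ p))) (x<y⇒0<y-x cJ<cL))
        (subst (0# <_) (sym deviations) (*-pos (0<x⇒0<x⁻¹ (0<ι[1+n] (suc p))) 0<excesses)))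
    where
    p = suc (suc k)
    J = inject₁ (fromℕ p)
    L = fromℕ (suc p)
    c′ : Fin (suc (suc p)) → Carrier
    c′ i = c (transpose J L ⟨$⟩ʳ i)
    s = partialSum c
    s′ = partialSum c′
    u = ι (suc (suc p)) ⁻¹
    pos⇒nonneg : ∀ {d : Fin (suc (suc p)) → Carrier} → (∀ i → 0# < d i) → ∀ i → 0# ≤ d i
    pos⇒nonneg 0<d i = inj₁ (0<d i)
    0<excesses : 0# < excess s J + excess s′ J
    0<excesses = crossed-bounds⇒0<sum k (0<c L) (0<c J) (excess-bound p c (pos⇒nonneg 0<c))
      (subst₂ (λ x y → ι p * x ≤ excess s′ J + y)
        (cong c (transpose-matchˡ J L)) (cong c (transpose-matchʳ J L))
        (excess-bound p c′ (pos⇒nonneg (0<c ∘ (transpose J L ⟨$⟩ʳ_)))))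
    deviations : (s′ J - mean s′) + (s J - mean s) ≡ u * (excess s J + excess s′ J)
    deviations = trans (cong₂ _+_ (deviation≡mean-excess s′ J) (deviation≡mean-excess s J))
      (solve 3 (λ u E E′ → u :* E′ :+ u :* E := u :* (E :+ E′)) refl u (excess s J) (excess s′ J))

  ordering-<-last : ∀ {n} (a : Fin (suc n) → Carrier) → (∀ i j → i Fin.< j → a i < a j) →
    (σ : Permutation′ (suc n)) → ordering a σ (fromℕ n) ≡ a (fromℕ n) →
    ∀ i → i ≢ fromℕ n → ordering a σ i < ordering a σ (fromℕ n)
  ordering-<-last {n} a a-mono σ c[L]≡a[L] i i≢L = subst (a (σ ⟨$⟩ʳ i) <_) (sym c[L]≡a[L])
    (a-mono _ _ (≤∧≢⇒< (≤fromℕ _) σi≢L))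
    where
    a-injective : ∀ {x y} → a x ≡ a y → x ≡ y
    a-injective {x} {y} ax≡ay with <-cmp x y
    ... | tri< x<y _ _ = contradiction (a-mono x y x<y) (<-irrefl ax≡ay)
    ... | tri≈ _ x≡y _ = x≡y
    ... | tri> _ _ y<x = contradiction (a-mono y x y<x) (<-irrefl (sym ax≡ay))
    σi≢L : σ ⟨$⟩ʳ i ≢ fromℕ n
    σi≢L σi≡L = i≢L (begin
      i                      ≡⟨ inverseˡ σ ⟨
      σ ⟨$⟩ˡ (σ ⟨$⟩ʳ i)      ≡⟨ cong (σ ⟨$⟩ˡ_) (trans σi≡L (sym (a-injective c[L]≡a[L]))) ⟩
      σ ⟨$⟩ˡ (σ ⟨$⟩ʳ fromℕ n)  ≡⟨ inverseˡ σ ⟩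
      fromℕ n                ∎)
      where open ≡-Reasoning

proposition2 : (F : OrderedField) → let open OrderedField F in
    (m : ℕ) → 2 ℕ.< m →
    (a : Fin (suc m) → Carrier) →
    (∀ i → 0# < a i) →
    (∀ i j → i Fin.< j → a i < a j) →
    (σ : Permutation′ (suc m)) →
    ordering a σ (fromℕ m) ≡ a (fromℕ m) →
    Σ (Permutation′ (suc m)) (λ σ′ → f (ordering a σ) < f (ordering a σ′))
proposition2 F (suc (suc (suc k))) (s≤s (s≤s (s≤s z≤n))) a 0<a a-mono σ c[L]≡a[L] =
  transpose J L ∘ₚ σ ,
  f-<-f∘transpose-last-two k (ordering a σ) (λ i → 0<a (σ ⟨$⟩ʳ i))
    (ordering-<-last a a-mono σ c[L]≡a[L] J (fromℕ≢inject₁ ∘ ≡.sym))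
  where
  open OrderedField F
  open OrderedFieldProperties F
  J = inject₁ (fromℕ (suc (suc k)))
  L = fromℕ (suc (suc (suc k)))
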